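{- Let $D$ be a finite digraph. Then the coreset digraph $Y(D)$ is the digraph obtained from $D$ by identifying the vertices of each nonempty coreset into a single vertex and deleting the resulting extra copies of edges (so $Y(D)$ has an edge from $U$ to $U'$ iff some vertex of $U$ has a successor in $U'$). Furthermore, $Y(D)=D$ (i.e. $Y(D)$ is isomorphic to $D$, via identifying each singleton coreset $\{v\}$ with $v$) if and only if each nonempty coreset of $D$ consists of a single vertex. Finally, the sequence $Y^n(D)$ converges as $n\to\infty$: there exist a digraph $F$ and an integer $N$ such that $Y^n(D)$ is isomorphic to $F$ for all $n\ge N$.
   Context: Digraphs are finite; loops allowed, no multiple edges. A sink is a vertex with no successors. For a vertex $v$, $\alpha(v)$ is the set of successors and $\beta(v)$ the set of predecessors of $v$; for nonempty $S$, $\alpha(S)=\bigcup_{v\in S}\alpha(v)$, $\beta(S)=\bigcup_{v\in S}\beta(v)$. A coreset of $D$ is either (1) the set of all sinks of $D$ (the trivial coreset), or (2) a minimal nonempty set $U\subseteq V(D)$ with $\beta(\alpha(U))=U$. The coresets of $D$ are pairwise disjoint and cover $V(D)$. The coreset digraph $Y(D)$ is the digraph (loops allowed, no multiple edges) whose vertices are the nonempty coresets of $D$, with an edge from $U_i$ to $U_j$ iff $\alpha(U_i)\cap U_j\neq\emptyset$ (loops $U_iU_i$ included when this holds with $i=j$). Set $Y^1(D)=Y(D)$ and $Y^n(D)=Y(Y^{n-1}(D))$ for $n\ge 2$. -}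

module Defs where

open import Data.Nat using (ℕ; zero; suc)
open import Data.Bool using (Bool; true; false; _∧_; _∨_; not; if_then_else_)
open import Data.Fin using (Fin; zero; suc)
open import Data.Fin.Subset using (Subset)
open import Data.Vec using (Vec; []; _∷_; tabulate; lookup)
open import Data.List as List using (List; []; _∷_; _++_; filter; length)
open import Data.Bool.Properties using (T?)
open import Function.Bundles using (_↔_; Inverse)
open import Relation.Binary.PropositionalEquality using (_≡_)

record Digraph : Set where
  field
    size : ℕ
    E    : Fin size → Fin size → Bool
open Digraph public

anyF : ∀ {n} → (Fin n → Bool) → Bool
anyF {zero}  f = false
anyF {suc n} f = f zero ∨ anyF (λ i → f (suc i))

allF : ∀ {n} → (Fin n → Bool) → Bool
allF {zero}  f = true
allF {suc n} f = f zero ∧ allF (λ i → f (suc i))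

allL : ∀ {A : Set} → (A → Bool) → List A → Bool
allL p []       = true
allL p (x ∷ xs) = p x ∧ allL p xs

_==ᵇ_ : Bool → Bool → Bool
true  ==ᵇ b = b
false ==ᵇ b = not b

module _ (D : Digraph) where
  private
    n = size D

  α : Subset n → Subset n
  α S = tabulate λ w → anyF λ v → lookup S v ∧ E D v w

  β : Subset n → Subset n
  β S = tabulate λ v → anyF λ w → E D v w ∧ lookup S w

  sinks : Subset n
  sinks = tabulate λ v → not (anyF (E D v))

allSubsets : ∀ n → List (Subset n)
allSubsets zero    = [] ∷ []
allSubsets (suc n) = List.map (true ∷_) (allSubsets n) ++ List.map (false ∷_) (allSubsets n)

nonemptyᵇ : ∀ {n} → Subset n → Bool
nonemptyᵇ U = anyF (lookup U)

eqᵇ : ∀ {n} → Subset n → Subset n → Bool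
eqᵇ U W = allF λ v → lookup U v ==ᵇ lookup W v

subsetᵇ : ∀ {n} → Subset n → Subset n → Bool
subsetᵇ W U = allF λ v → not (lookup W v) ∨ lookup U v

module _ (D : Digraph) where
  private
    n = size D

  closedᵇ : Subset n → Bool
  closedᵇ U = nonemptyᵇ U ∧ eqᵇ (β D (α D U)) U

  minClosedᵇ : Subset n → Bool
  minClosedᵇ U = closedᵇ U ∧
    allL (λ W → not (closedᵇ W ∧ subsetᵇ W U ∧ not (eqᵇ W U))) (allSubsets n)

  isCoresetᵇ : Subset n → Bool
  isCoresetᵇ U = eqᵇ U (sinks D) ∨ minClosedᵇ U

  coresets : List (Subset n)
  coresets = filter (λ U → T? (nonemptyᵇ U ∧ isCoresetᵇ U)) (allSubsets n)

Y : Digraph → Digraph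
Y D = record
  { size = length (coresets D)
  ; E    = λ i j → anyF λ w → lookup (α D (List.lookup (coresets D) i)) w
                              ∧ lookup (List.lookup (coresets D) j) w
  }

Yⁿ : ℕ → Digraph → Digraph
Yⁿ zero    D = D
Yⁿ (suc k) D = Y (Yⁿ k D)

record Iso (D D′ : Digraph) : Set where
  field
    bij   : Fin (size D) ↔ Fin (size D′)
    edges : ∀ u v → E D u v ≡ E D′ (Inverse.to bij u) (Inverse.to bij v)

-- Unfolded, β(α(U)) = U says that U is a nonempty set of non-sinks that
-- contains every vertex sharing a successor with one of its members.  Such
-- closed sets are stable under meeting intersections and under removing
-- another closed set, so minimal ones are pairwise disjoint, and the
-- intersection of all closed sets containing a non-sink v is minimal; with
-- the sinks they partition V(D).  One representative per coreset injects
-- V(Y D) into V(D), onto exactly when all coresets are singletons, i.e. when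
-- D has at most one sink and no two vertices share a successor.  That
-- property is invariant under isomorphism, so |Yⁿ D| decreases until Y
-- fixes the digraph up to isomorphism.

module Submission where

open import Defs
open import Data.Nat using (ℕ; zero; suc; _+_; _∸_; _≤_; _<_)
open import Data.Nat.Properties
  using (≤-refl; ≤-antisym; ≤∧≢⇒<; ≤-pred; <-≤-trans; <-irrefl; n≮0; m∸n+n≡m)
  renaming (_≟_ to _≟ℕ_)
open import Data.Bool using (Bool; true; false; _∧_; _∨_; not; T)
open import Data.Bool.Properties
  using (∧-conicalˡ; ∧-conicalʳ; ∨-zeroʳ; not-involutive; T?; T-≡; ⇔→≡)
  renaming (_≟_ to _≟ᵇ_)
open import Data.Fin using (Fin; zero; suc; _≟_)
open import Data.Fin.Properties using (injective⇒≤)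
open import Data.Fin.Subset using (Subset; _∈_; _∉_; _⊆_; _∩_; ∁; ⋂; ⁅_⁆; Nonempty)
open import Data.Fin.Subset.Properties
  using (∈⊤; x∈p∩q⁺; x∈p∩q⁻; p∩q⊆p; p∩q⊆q; x∈∁p⇒x∉p; x∉p⇒x∈∁p; x∈⁅x⁆; x∈⁅y⁆⇒x≡y;
         ⊆-antisym; drop-∷-⊆; _∈?_)
open import Data.Vec using ([]; _∷_; here; there; lookup; tabulate)
open import Data.Vec.Properties using (lookup∘tabulate; []=⇒lookup; lookup⇒[]=; ∷-injectiveʳ)
import Data.Vec.Functional as Vector
open import Data.List as List using (List; []; _∷_; filter)
open import Data.List.Membership.Propositional using () renaming (_∈_ to _∈ˡ_)
open import Data.List.Membership.Propositional.Properties
  using (∈-map⁺; ∈-map⁻; ∈-++⁺ˡ; ∈-++⁺ʳ; ∈-lookup; ∈-filter⁺; ∈-filter⁻)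
open import Data.List.Relation.Unary.Any as Any using ()
open import Data.List.Relation.Unary.Any.Properties using (lookup-index)
open import Data.List.Relation.Unary.All as All using (All; []; _∷_)
open import Data.List.Relation.Unary.AllPairs using ([]; _∷_)
open import Data.List.Relation.Unary.Unique.Propositional using (Unique)
import Data.List.Relation.Unary.Unique.Propositional.Properties as Unique
open import Data.Product using (Σ; ∃-syntax; _×_; _,_; proj₁; proj₂)
open import Data.Sum as Sum using (_⊎_; inj₁; inj₂)
open import Data.Empty using (⊥-elim)
open import Function using (_∘_; case_of_)
open import Function.Bundles using (_⇔_; mk⇔; Equivalence; Inverse; Injection; mk↔ₛ′)
open import Function.Construct.Composition using (_⇔-∘_)
open import Function.Definitions using (Injective)
open import Function.Properties.Inverse using (↔-refl; ↔-trans; ↔-sym; ↔⇒↣)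
open import Relation.Nullary using (¬_; Dec; yes; no; contradiction)
open import Relation.Nullary.Decidable using (map′; _×-dec_)
open import Relation.Binary.PropositionalEquality
  using (_≡_; _≢_; refl; sym; trans; cong; cong₂; subst; subst₂)

∨-true⁻ : ∀ a {b} → a ∨ b ≡ true → a ≡ true ⊎ b ≡ true
∨-true⁻ true  _ = inj₁ refl
∨-true⁻ false p = inj₂ p

==ᵇ⇒≡ : ∀ {a b} → (a ==ᵇ b) ≡ true → a ≡ b
==ᵇ⇒≡ {true}          p  = sym p
==ᵇ⇒≡ {false} {false} _  = refl
==ᵇ⇒≡ {false} {true}  ()

==ᵇ-refl : ∀ a → (a ==ᵇ a) ≡ true
==ᵇ-refl true  = refl
==ᵇ-refl false = refl

not-∧-∧-not⁻ : ∀ a b c → not (a ∧ b ∧ not c) ≡ true → a ≡ true → b ≡ true → c ≡ true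
not-∧-∧-not⁻ true  true  true  _  _  _  = refl
not-∧-∧-not⁻ true  true  false () _  _
not-∧-∧-not⁻ true  false _     _  _  ()
not-∧-∧-not⁻ false _     _     _  () _

not-∧-∧-not⁺ : ∀ a b c → (a ≡ true → b ≡ true → c ≡ true) → not (a ∧ b ∧ not c) ≡ true
not-∧-∧-not⁺ true  true  c h = trans (not-involutive c) (h refl refl)
not-∧-∧-not⁺ true  false _ _ = refl
not-∧-∧-not⁺ false _     _ _ = refl

anyF⁺ : ∀ {n} (f : Fin n → Bool) i → f i ≡ true → anyF f ≡ true
anyF⁺ f zero    p = cong (_∨ anyF (f ∘ suc)) p
anyF⁺ f (suc i) p = trans (cong (f zero ∨_) (anyF⁺ (f ∘ suc) i p)) (∨-zeroʳ (f zero))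

anyF⁻ : ∀ {n} (f : Fin n → Bool) → anyF f ≡ true → ∃[ i ] f i ≡ true
anyF⁻ {zero}  f ()
anyF⁻ {suc n} f p with ∨-true⁻ (f zero) p
... | inj₁ q = zero , q
... | inj₂ q = let i , r = anyF⁻ (f ∘ suc) q in suc i , r

not-anyF⁺ : ∀ {n} (f : Fin n → Bool) → (∀ i → f i ≢ true) → not (anyF f) ≡ true
not-anyF⁺ f none with anyF f in eq
... | true  = let i , p = anyF⁻ f eq in ⊥-elim (none i p)
... | false = refl

not-anyF⁻ : ∀ {n} (f : Fin n → Bool) → not (anyF f) ≡ true → ∀ i → f i ≢ true
not-anyF⁻ f p i q = case subst (λ b → not b ≡ true) (anyF⁺ f i q) p of λ ()

allL⇒All : ∀ {A : Set} (p : A → Bool) xs → allL p xs ≡ true → All (λ x → p x ≡ true) xs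
allL⇒All p []       _ = []
allL⇒All p (x ∷ xs) q = ∧-conicalˡ (p x) _ q ∷ allL⇒All p xs (∧-conicalʳ (p x) _ q)

All⇒allL : ∀ {A : Set} (p : A → Bool) xs → All (λ x → p x ≡ true) xs → allL p xs ≡ true
All⇒allL p []       []         = refl
All⇒allL p (x ∷ xs) (px ∷ pxs) = cong₂ _∧_ px (All⇒allL p xs pxs)

∈-tabulate⁺ : ∀ {n} {f : Fin n → Bool} {x} → f x ≡ true → x ∈ tabulate f
∈-tabulate⁺ {f = f} {x} p = lookup⇒[]= x _ (trans (lookup∘tabulate f x) p)

∈-tabulate⁻ : ∀ {n} {f : Fin n → Bool} {x} → x ∈ tabulate f → f x ≡ true
∈-tabulate⁻ {f = f} {x} p = trans (sym (lookup∘tabulate f x)) ([]=⇒lookup p)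

nonemptyᵇ⇒Nonempty : ∀ {n} (U : Subset n) → nonemptyᵇ U ≡ true → Nonempty U
nonemptyᵇ⇒Nonempty U p = let x , q = anyF⁻ (lookup U) p in x , lookup⇒[]= x U q

Nonempty⇒nonemptyᵇ : ∀ {n} {U : Subset n} → Nonempty U → nonemptyᵇ U ≡ true
Nonempty⇒nonemptyᵇ {U = U} (x , x∈U) = anyF⁺ (lookup U) x ([]=⇒lookup x∈U)

eqᵇ⇒≡ : ∀ {n} (U W : Subset n) → eqᵇ U W ≡ true → U ≡ W
eqᵇ⇒≡ []      []      _ = refl
eqᵇ⇒≡ (a ∷ U) (b ∷ W) p =
  cong₂ _∷_ (==ᵇ⇒≡ (∧-conicalˡ _ _ p)) (eqᵇ⇒≡ U W (∧-conicalʳ (a ==ᵇ b) _ p))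

eqᵇ-refl : ∀ {n} (U : Subset n) → eqᵇ U U ≡ true
eqᵇ-refl []      = refl
eqᵇ-refl (a ∷ U) = cong₂ _∧_ (==ᵇ-refl a) (eqᵇ-refl U)

subsetᵇ⇒⊆ : ∀ {n} (W U : Subset n) → subsetᵇ W U ≡ true → W ⊆ U
subsetᵇ⇒⊆ (true ∷ W) (true  ∷ U) p  here      = here
subsetᵇ⇒⊆ (true ∷ W) (false ∷ U) () here
subsetᵇ⇒⊆ (a    ∷ W) (b     ∷ U) p  (there x) = there (subsetᵇ⇒⊆ W U (∧-conicalʳ (not a ∨ b) _ p) x)

⊆⇒subsetᵇ : ∀ {n} (W U : Subset n) → W ⊆ U → subsetᵇ W U ≡ true
⊆⇒subsetᵇ []          []      _   = refl
⊆⇒subsetᵇ (true  ∷ W) (b ∷ U) W⊆U = cong₂ _∧_ ([]=⇒lookup (W⊆U here)) (⊆⇒subsetᵇ W U (drop-∷-⊆ W⊆U))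
⊆⇒subsetᵇ (false ∷ W) (b ∷ U) W⊆U = ⊆⇒subsetᵇ W U (drop-∷-⊆ W⊆U)

∈⁅⁆⇒≡ : ∀ {n} {v x y : Fin n} → x ∈ ⁅ v ⁆ → y ∈ ⁅ v ⁆ → x ≡ y
∈⁅⁆⇒≡ {v = v} x∈ y∈ = trans (x∈⁅y⁆⇒x≡y v x∈) (sym (x∈⁅y⁆⇒x≡y v y∈))

⊆⁅⁆⇒≡⁅⁆ : ∀ {n} {p : Subset n} {x} → x ∈ p → (∀ {y} → y ∈ p → y ≡ x) → p ≡ ⁅ x ⁆
⊆⁅⁆⇒≡⁅⁆ {x = x} x∈p ≡x = ⊆-antisym
  (λ y∈p → subst (_∈ ⁅ x ⁆) (sym (≡x y∈p)) (x∈⁅x⁆ x))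
  (λ y∈⁅x⁆ → subst (_∈ _) (sym (x∈⁅y⁆⇒x≡y x y∈⁅x⁆)) x∈p)

∈⋂⁺ : ∀ {n} {x : Fin n} {Ws} → All (x ∈_) Ws → x ∈ ⋂ Ws
∈⋂⁺ []         = ∈⊤
∈⋂⁺ (px ∷ pxs) = x∈p∩q⁺ (px , ∈⋂⁺ pxs)

∈⋂⁻ : ∀ {n} {x : Fin n} Ws → x ∈ ⋂ Ws → All (x ∈_) Ws
∈⋂⁻ []       _ = []
∈⋂⁻ (W ∷ Ws) p = let x∈W , x∈⋂Ws = x∈p∩q⁻ W (⋂ Ws) p in x∈W ∷ ∈⋂⁻ Ws x∈⋂Ws

∈-allSubsets : ∀ {n} (U : Subset n) → U ∈ˡ allSubsets n
∈-allSubsets []          = Any.here refl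
∈-allSubsets (true  ∷ U) = ∈-++⁺ˡ (∈-map⁺ (true ∷_) (∈-allSubsets U))
∈-allSubsets (false ∷ U) =
  ∈-++⁺ʳ (List.map (true ∷_) (allSubsets _)) (∈-map⁺ (false ∷_) (∈-allSubsets U))

allSubsets-unique : ∀ n → Unique (allSubsets n)
allSubsets-unique zero    = [] ∷ []
allSubsets-unique (suc n) =
  Unique.++⁺ (Unique.map⁺ ∷-injectiveʳ (allSubsets-unique n))
             (Unique.map⁺ ∷-injectiveʳ (allSubsets-unique n))
             heads-differ
  where
  heads-differ : ∀ {U} → ¬ (U ∈ˡ List.map (true ∷_) (allSubsets n) × U ∈ˡ List.map (false ∷_) (allSubsets n))
  heads-differ (p , q) with ∈-map⁻ (true ∷_) p | ∈-map⁻ (false ∷_) q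
  ... | _ , _ , refl | _ , _ , ()

lookup-injective : ∀ {A : Set} {xs : List A} → Unique xs → ∀ {i j} → List.lookup xs i ≡ List.lookup xs j → i ≡ j
lookup-injective (_    ∷ _) {zero}  {zero}  _ = refl
lookup-injective (x∉xs ∷ _) {zero}  {suc j} e = ⊥-elim (All.lookup x∉xs (∈-lookup j) e)
lookup-injective (x∉xs ∷ _) {suc i} {zero}  e = ⊥-elim (All.lookup x∉xs (∈-lookup i) (sym e))
lookup-injective (_    ∷ u) {suc i} {suc j} e = cong suc (lookup-injective u e)

injective-missing⇒< : ∀ {m n} {f : Fin m → Fin n} {y} → Injective _≡_ _≡_ f → (∀ i → f i ≢ y) → m < n
injective-missing⇒< {f = f} {y} f-injective missing = injective⇒≤ y∷f-injective
  where
  y∷f-injective : Injective _≡_ _≡_ (y Vector.∷ f)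
  y∷f-injective {zero}  {zero}  _ = refl
  y∷f-injective {zero}  {suc j} e = ⊥-elim (missing j (sym e))
  y∷f-injective {suc i} {zero}  e = ⊥-elim (missing i e)
  y∷f-injective {suc i} {suc j} e = cong suc (f-injective e)

Iso-refl : ∀ {G} → Iso G G
Iso-refl = record { bij = ↔-refl ; edges = λ _ _ → refl }

Iso-trans : ∀ {G H K} → Iso G H → Iso H K → Iso G K
Iso-trans φ ψ = record
  { bij   = ↔-trans (Iso.bij φ) (Iso.bij ψ)
  ; edges = λ u v → trans (Iso.edges φ u v) (Iso.edges ψ _ _)
  }

module CoresetTheory (D : Digraph) where

  private
    n : ℕ
    n = size D

  infix 4 _⟶_
  _⟶_ : Fin n → Fin n → Set
  u ⟶ v = E D u v ≡ true

  IsSink : Fin n → Set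
  IsSink v = ∀ {w} → ¬ v ⟶ w

  ∈α⁺ : ∀ {S u v} → u ∈ S → u ⟶ v → v ∈ α D S
  ∈α⁺ {S} {u} {v} u∈S u⟶v =
    ∈-tabulate⁺ (anyF⁺ (λ x → lookup S x ∧ E D x v) u (cong₂ _∧_ ([]=⇒lookup u∈S) u⟶v))

  ∈α⁻ : ∀ {S v} → v ∈ α D S → ∃[ u ] u ∈ S × u ⟶ v
  ∈α⁻ {S} {v} v∈αS =
    let u , p = anyF⁻ (λ x → lookup S x ∧ E D x v) (∈-tabulate⁻ v∈αS)
    in u , lookup⇒[]= u S (∧-conicalˡ _ _ p) , ∧-conicalʳ (lookup S u) _ p

  ∈β⁺ : ∀ {S u v} → u ⟶ v → v ∈ S → u ∈ β D S
  ∈β⁺ {S} {u} {v} u⟶v v∈S =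
    ∈-tabulate⁺ (anyF⁺ (λ x → E D u x ∧ lookup S x) v (cong₂ _∧_ u⟶v ([]=⇒lookup v∈S)))

  ∈β⁻ : ∀ {S u} → u ∈ β D S → ∃[ v ] u ⟶ v × v ∈ S
  ∈β⁻ {S} {u} u∈βS =
    let v , p = anyF⁻ (λ x → E D u x ∧ lookup S x) (∈-tabulate⁻ u∈βS)
    in v , ∧-conicalˡ _ _ p , lookup⇒[]= v S (∧-conicalʳ (E D u v) _ p)

  ∈sinks⁺ : ∀ {v} → IsSink v → v ∈ sinks D
  ∈sinks⁺ v-sink = ∈-tabulate⁺ (not-anyF⁺ (E D _) λ _ → v-sink)

  ∈sinks⁻ : ∀ {v} → v ∈ sinks D → IsSink v
  ∈sinks⁻ v∈sinks = not-anyF⁻ (E D _) (∈-tabulate⁻ v∈sinks) _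

  sink-or-successor : ∀ v → IsSink v ⊎ ∃[ w ] v ⟶ w
  sink-or-successor v with anyF (E D v) in eq
  ... | true  = inj₂ (anyF⁻ (E D v) eq)
  ... | false = inj₁ λ v⟶w → case trans (sym eq) (anyF⁺ (E D v) _ v⟶w) of λ ()

  ∈nonSinks⁺ : ∀ {v w} → v ⟶ w → v ∈ ∁ (sinks D)
  ∈nonSinks⁺ v⟶w = x∉p⇒x∈∁p λ v∈sinks → ∈sinks⁻ v∈sinks v⟶w

  ∈nonSinks⁻ : ∀ {v} → v ∈ ∁ (sinks D) → ∃[ w ] v ⟶ w
  ∈nonSinks⁻ {v} v∈ with sink-or-successor v
  ... | inj₁ v-sink    = ⊥-elim (x∈∁p⇒x∉p v∈ (∈sinks⁺ v-sink))
  ... | inj₂ successor = successor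

  -- β (α U) = U unfolded: U ⊆ β (α U) is has-successor, β (α U) ⊆ U is pred-closed.
  record Closed (U : Subset n) : Set where
    field
      nonempty      : Nonempty U
      has-successor : ∀ {u} → u ∈ U → ∃[ w ] u ⟶ w
      pred-closed   : ∀ {u v w} → u ∈ U → u ⟶ w → v ⟶ w → v ∈ U

  MinimalClosed : Subset n → Set
  MinimalClosed U = Closed U × (∀ {W} → Closed W → W ⊆ U → W ≡ U)

  NonemptyCoreset : Subset n → Set
  NonemptyCoreset U = Nonempty U × (U ≡ sinks D ⊎ MinimalClosed U)

  closedᵇ⇒Closed : ∀ U → closedᵇ D U ≡ true → Closed U
  closedᵇ⇒Closed U p = record
    { nonempty      = nonemptyᵇ⇒Nonempty U (∧-conicalˡ _ _ p)
    ; has-successor = λ u∈U →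
        let w , u⟶w , _ = ∈β⁻ {α D U} (subst (_ ∈_) (sym βαU≡U) u∈U) in w , u⟶w
    ; pred-closed   = λ u∈U u⟶w v⟶w → subst (_ ∈_) βαU≡U (∈β⁺ {α D U} v⟶w (∈α⁺ u∈U u⟶w))
    }
    where
    βαU≡U : β D (α D U) ≡ U
    βαU≡U = eqᵇ⇒≡ _ U (∧-conicalʳ (nonemptyᵇ U) _ p)

  Closed⇒closedᵇ : ∀ {U} → Closed U → closedᵇ D U ≡ true
  Closed⇒closedᵇ {U} cU =
    cong₂ _∧_ (Nonempty⇒nonemptyᵇ nonempty) (subst (λ X → eqᵇ X U ≡ true) (sym βαU≡U) (eqᵇ-refl U))
    where
    open Closed cU
    βαU≡U : β D (α D U) ≡ U
    βαU≡U = ⊆-antisym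
      (λ v∈βαU → let w , v⟶w , w∈αU = ∈β⁻ {α D U} v∈βαU
                     u , u∈U , u⟶w = ∈α⁻ w∈αU
                 in pred-closed u∈U u⟶w v⟶w)
      (λ u∈U → let w , u⟶w = has-successor u∈U in ∈β⁺ u⟶w (∈α⁺ u∈U u⟶w))

  closed? : ∀ U → Dec (Closed U)
  closed? U = map′ (closedᵇ⇒Closed U) Closed⇒closedᵇ (closedᵇ D U ≟ᵇ true)

  minClosedᵇ⇒MinimalClosed : ∀ U → minClosedᵇ D U ≡ true → MinimalClosed U
  minClosedᵇ⇒MinimalClosed U p = closedᵇ⇒Closed U (∧-conicalˡ _ _ p) , minimal
    where
    noProperClosedSubset = allL⇒All _ (allSubsets n) (∧-conicalʳ (closedᵇ D U) _ p)
    minimal : ∀ {W} → Closed W → W ⊆ U → W ≡ U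
    minimal {W} cW W⊆U = eqᵇ⇒≡ W U
      (not-∧-∧-not⁻ _ _ _ (All.lookup noProperClosedSubset (∈-allSubsets W))
                          (Closed⇒closedᵇ cW) (⊆⇒subsetᵇ W U W⊆U))

  MinimalClosed⇒minClosedᵇ : ∀ {U} → MinimalClosed U → minClosedᵇ D U ≡ true
  MinimalClosed⇒minClosedᵇ {U} (cU , minimal) =
    cong₂ _∧_ (Closed⇒closedᵇ cU)
              (All⇒allL _ (allSubsets n) (All.universal noProperClosedSubset (allSubsets n)))
    where
    noProperClosedSubset : ∀ W → not (closedᵇ D W ∧ subsetᵇ W U ∧ not (eqᵇ W U)) ≡ true
    noProperClosedSubset W = not-∧-∧-not⁺ _ _ _ λ cW W⊆U →
      subst (λ X → eqᵇ W X ≡ true) (minimal (closedᵇ⇒Closed W cW) (subsetᵇ⇒⊆ W U W⊆U)) (eqᵇ-refl W)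

  coresetᵇ⇒NonemptyCoreset : ∀ U → (nonemptyᵇ U ∧ isCoresetᵇ D U) ≡ true → NonemptyCoreset U
  coresetᵇ⇒NonemptyCoreset U p =
    nonemptyᵇ⇒Nonempty U (∧-conicalˡ _ _ p) ,
    Sum.map (eqᵇ⇒≡ U (sinks D)) (minClosedᵇ⇒MinimalClosed U)
            (∨-true⁻ (eqᵇ U (sinks D)) (∧-conicalʳ (nonemptyᵇ U) _ p))

  NonemptyCoreset⇒coresetᵇ : ∀ {U} → NonemptyCoreset U → (nonemptyᵇ U ∧ isCoresetᵇ D U) ≡ true
  NonemptyCoreset⇒coresetᵇ {U} (ne , inj₁ refl) =
    cong₂ _∧_ (Nonempty⇒nonemptyᵇ ne) (cong (_∨ minClosedᵇ D U) (eqᵇ-refl U))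
  NonemptyCoreset⇒coresetᵇ {U} (ne , inj₂ mc) =
    cong₂ _∧_ (Nonempty⇒nonemptyᵇ ne)
              (trans (cong (eqᵇ U (sinks D) ∨_) (MinimalClosed⇒minClosedᵇ mc)) (∨-zeroʳ _))

  closed-∩ : ∀ {U W x} → Closed U → Closed W → x ∈ U → x ∈ W → Closed (U ∩ W)
  closed-∩ {U} {W} cU cW x∈U x∈W = record
    { nonempty      = _ , x∈p∩q⁺ (x∈U , x∈W)
    ; has-successor = λ u∈ → Closed.has-successor cU (p∩q⊆p U W u∈)
    ; pred-closed   = λ u∈ u⟶w v⟶w →
        x∈p∩q⁺ ( Closed.pred-closed cU (p∩q⊆p U W u∈) u⟶w v⟶w
               , Closed.pred-closed cW (p∩q⊆q U W u∈) u⟶w v⟶w)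
    }

  -- Sharing a successor is symmetric, so the complement of a
  -- predecessor-closed set is predecessor-closed as well.
  closed-∖ : ∀ {U W x} → Closed U → Closed W → x ∈ U → x ∉ W → Closed (U ∩ ∁ W)
  closed-∖ {U} {W} cU cW x∈U x∉W = record
    { nonempty      = _ , x∈p∩q⁺ (x∈U , x∉p⇒x∈∁p x∉W)
    ; has-successor = λ u∈ → Closed.has-successor cU (p∩q⊆p U (∁ W) u∈)
    ; pred-closed   = λ u∈ u⟶w v⟶w →
        let u∈U , u∈∁W = x∈p∩q⁻ U (∁ W) u∈
        in x∈p∩q⁺ ( Closed.pred-closed cU u∈U u⟶w v⟶w
                  , x∉p⇒x∈∁p λ v∈W → x∈∁p⇒x∉p u∈∁W (Closed.pred-closed cW v∈W v⟶w u⟶w))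
    }

  minimalClosed-disjoint : ∀ {U W x} → MinimalClosed U → MinimalClosed W → x ∈ U → x ∈ W → U ≡ W
  minimalClosed-disjoint {U} {W} (cU , minimalU) (cW , minimalW) x∈U x∈W =
    trans (sym (minimalU cU∩W (p∩q⊆p U W))) (minimalW cU∩W (p∩q⊆q U W))
    where
    cU∩W = closed-∩ cU cW x∈U x∈W

  nonemptyCoreset-disjoint : ∀ {U W x} → NonemptyCoreset U → NonemptyCoreset W → x ∈ U → x ∈ W → U ≡ W
  nonemptyCoreset-disjoint (_ , inj₁ U≡sinks) (_ , inj₁ W≡sinks) _ _ = trans U≡sinks (sym W≡sinks)
  nonemptyCoreset-disjoint (_ , inj₁ refl) (_ , inj₂ (cW , _)) x∈sinks x∈W =
    ⊥-elim (∈sinks⁻ x∈sinks (proj₂ (Closed.has-successor cW x∈W)))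
  nonemptyCoreset-disjoint (_ , inj₂ (cU , _)) (_ , inj₁ refl) x∈U x∈sinks =
    ⊥-elim (∈sinks⁻ x∈sinks (proj₂ (Closed.has-successor cU x∈U)))
  nonemptyCoreset-disjoint (_ , inj₂ mU) (_ , inj₂ mW) x∈U x∈W = minimalClosed-disjoint mU mW x∈U x∈W

  nonSinks-closed : ∀ {v w} → v ⟶ w → Closed (∁ (sinks D))
  nonSinks-closed v⟶w = record
    { nonempty      = _ , ∈nonSinks⁺ v⟶w
    ; has-successor = ∈nonSinks⁻
    ; pred-closed   = λ _ _ v⟶w → ∈nonSinks⁺ v⟶w
    }

  closedContaining? : ∀ v W → Dec (Closed W × v ∈ W)
  closedContaining? v W = closed? W ×-dec v ∈? W

  closure : Fin n → Subset n
  closure v = ⋂ (filter (closedContaining? v) (allSubsets n))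

  ∈closure⁺ : ∀ {v x} → (∀ {W} → Closed W → v ∈ W → x ∈ W) → x ∈ closure v
  ∈closure⁺ {v} x∈closed = ∈⋂⁺ (All.tabulate λ W∈ →
    let _ , cW , v∈W = ∈-filter⁻ (closedContaining? v) {xs = allSubsets n} W∈ in x∈closed cW v∈W)

  ∈closure⁻ : ∀ {v x W} → x ∈ closure v → Closed W → v ∈ W → x ∈ W
  ∈closure⁻ {v} {W = W} x∈ cW v∈W =
    All.lookup (∈⋂⁻ _ x∈) (∈-filter⁺ (closedContaining? v) (∈-allSubsets W) (cW , v∈W))

  v∈closure : ∀ v → v ∈ closure v
  v∈closure v = ∈closure⁺ λ _ v∈W → v∈W

  closure-minimalClosed : ∀ {v w} → v ⟶ w → MinimalClosed (closure v)
  closure-minimalClosed {v} v⟶w = closure-closed , minimal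
    where
    closure-closed : Closed (closure v)
    closure-closed = record
      { nonempty      = v , v∈closure v
      ; has-successor = λ u∈ → ∈nonSinks⁻ (∈closure⁻ u∈ (nonSinks-closed v⟶w) (∈nonSinks⁺ v⟶w))
      ; pred-closed   = λ u∈ u⟶x y⟶x → ∈closure⁺ λ cW v∈W →
          Closed.pred-closed cW (∈closure⁻ u∈ cW v∈W) u⟶x y⟶x
      }
    minimal : ∀ {W} → Closed W → W ⊆ closure v → W ≡ closure v
    minimal {W} cW W⊆closure with v ∈? W
    ... | yes v∈W = ⊆-antisym W⊆closure λ x∈ → ∈closure⁻ x∈ cW v∈W
    -- Otherwise closure v ∖ W is a closed set containing v, so it contains closure v ⊇ W ≠ ∅.
    ... | no  v∉W = ⊥-elim (x∈∁p⇒x∉p (proj₂ (x∈p∩q⁻ _ (∁ W) y∈closure∖W)) y∈W)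
      where
      y∈W = proj₂ (Closed.nonempty cW)
      y∈closure∖W = ∈closure⁻ (W⊆closure y∈W)
        (closed-∖ closure-closed cW (v∈closure v) v∉W) (x∈p∩q⁺ (v∈closure v , x∉p⇒x∈∁p v∉W))

  nonemptyCoreset-cover : ∀ v → ∃[ U ] NonemptyCoreset U × v ∈ U
  nonemptyCoreset-cover v with sink-or-successor v
  ... | inj₁ v-sink       = sinks D , ((v , ∈sinks⁺ v-sink) , inj₁ refl) , ∈sinks⁺ v-sink
  ... | inj₂ (w , v⟶w) = closure v , ((v , v∈closure v) , inj₂ (closure-minimalClosed v⟶w)) , v∈closure v

  coreset : Fin (size (Y D)) → Subset n
  coreset = List.lookup (coresets D)

  private
    isCoreset? : ∀ U → Dec (T (nonemptyᵇ U ∧ isCoresetᵇ D U))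
    isCoreset? U = T? (nonemptyᵇ U ∧ isCoresetᵇ D U)

  coreset-nonemptyCoreset : ∀ i → NonemptyCoreset (coreset i)
  coreset-nonemptyCoreset i = coresetᵇ⇒NonemptyCoreset _
    (Equivalence.to T-≡ (proj₂ (∈-filter⁻ isCoreset? {xs = allSubsets n} (∈-lookup i))))

  nonemptyCoreset⇒coreset : ∀ {U} → NonemptyCoreset U → ∃[ i ] U ≡ coreset i
  nonemptyCoreset⇒coreset {U} c = Any.index U∈coresets , lookup-index U∈coresets
    where
    U∈coresets : U ∈ˡ coresets D
    U∈coresets = ∈-filter⁺ isCoreset? (∈-allSubsets U) (Equivalence.from T-≡ (NonemptyCoreset⇒coresetᵇ c))

  coreset-injective : ∀ {i j} → coreset i ≡ coreset j → i ≡ j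
  coreset-injective = lookup-injective (Unique.filter⁺ isCoreset? (allSubsets-unique n))

  coreset-disjoint : ∀ {i j x} → x ∈ coreset i → x ∈ coreset j → i ≡ j
  coreset-disjoint {i} {j} x∈i x∈j = coreset-injective
    (nonemptyCoreset-disjoint (coreset-nonemptyCoreset i) (coreset-nonemptyCoreset j) x∈i x∈j)

  coreset-cover : ∀ v → ∃[ i ] v ∈ coreset i
  coreset-cover v =
    let U , c , v∈U = nonemptyCoreset-cover v
        i , U≡i     = nonemptyCoreset⇒coreset c
    in i , subst (v ∈_) U≡i v∈U

  block : Fin n → Fin (size (Y D))
  block v = proj₁ (coreset-cover v)

  ∈-block : ∀ v → v ∈ coreset (block v)
  ∈-block v = proj₂ (coreset-cover v)

  Y-edge⇔ : ∀ i j → E (Y D) i j ≡ true ⇔ (∃[ u ] ∃[ v ] (u ∈ coreset i × v ∈ coreset j × u ⟶ v))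
  Y-edge⇔ i j = mk⇔ edge⇒ edge⇐
    where
    meets : Fin n → Bool
    meets w = lookup (α D (coreset i)) w ∧ lookup (coreset j) w
    edge⇒ : E (Y D) i j ≡ true → ∃[ u ] ∃[ v ] (u ∈ coreset i × v ∈ coreset j × u ⟶ v)
    edge⇒ p =
      let w , q          = anyF⁻ meets p
          u , u∈i , u⟶w = ∈α⁻ (lookup⇒[]= w _ (∧-conicalˡ _ _ q))
      in u , w , u∈i , lookup⇒[]= w _ (∧-conicalʳ (lookup (α D (coreset i)) w) _ q) , u⟶w
    edge⇐ : ∃[ u ] ∃[ v ] (u ∈ coreset i × v ∈ coreset j × u ⟶ v) → E (Y D) i j ≡ true
    edge⇐ (u , v , u∈i , v∈j , u⟶v) =
      anyF⁺ meets v (cong₂ _∧_ ([]=⇒lookup (∈α⁺ u∈i u⟶v)) ([]=⇒lookup v∈j))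

  representative : Fin (size (Y D)) → Fin n
  representative i = proj₁ (proj₁ (coreset-nonemptyCoreset i))

  representative-∈ : ∀ i → representative i ∈ coreset i
  representative-∈ i = proj₂ (proj₁ (coreset-nonemptyCoreset i))

  representative-injective : Injective _≡_ _≡_ representative
  representative-injective {i} {j} r≡r =
    coreset-disjoint (representative-∈ i) (subst (_∈ coreset j) (sym r≡r) (representative-∈ j))

  size-Y≤size : size (Y D) ≤ n
  size-Y≤size = injective⇒≤ representative-injective

  AllSingletons : Set
  AllSingletons = ∀ i → ∃[ v ] coreset i ≡ ⁅ v ⁆

  size-Y≡size⇒allSingletons : size (Y D) ≡ n → AllSingletons
  size-Y≡size⇒allSingletons size≡ i = representative i , ⊆⁅⁆⇒≡⁅⁆ (representative-∈ i) ≡representative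
    where
    ≡representative : ∀ {y} → y ∈ coreset i → y ≡ representative i
    ≡representative {y} y∈i with y ≟ representative i
    ... | yes y≡r = y≡r
    -- y together with all representatives would be size (Y D) + 1 distinct vertices.
    ... | no  y≢r = contradiction (injective-missing⇒< representative-injective y-missing) (<-irrefl size≡)
      where
      y-missing : ∀ j → representative j ≢ y
      y-missing j r≡y = y≢r (trans (sym r≡y) (cong representative
        (coreset-disjoint (subst (_∈ coreset j) r≡y (representative-∈ j)) y∈i)))

  size-Y<size⊎allSingletons : size (Y D) < n ⊎ AllSingletons
  size-Y<size⊎allSingletons with size (Y D) ≟ℕ n
  ... | yes size≡ = inj₂ (size-Y≡size⇒allSingletons size≡)
  ... | no  size≢ = inj₁ (≤∧≢⇒< size-Y≤size size≢)

  allSingletons⇒Iso : AllSingletons → Σ (Iso (Y D) D) λ φ → ∀ i → Inverse.to (Iso.bij φ) i ∈ coreset i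
  allSingletons⇒Iso single =
    record { bij = mk↔ₛ′ element block element-block block-element ; edges = edges } , element-∈
    where
    element : Fin (size (Y D)) → Fin n
    element i = proj₁ (single i)
    element-∈ : ∀ i → element i ∈ coreset i
    element-∈ i = subst (element i ∈_) (sym (proj₂ (single i))) (x∈⁅x⁆ (element i))
    ∈⇒≡element : ∀ {i x} → x ∈ coreset i → x ≡ element i
    ∈⇒≡element {i} x∈i = x∈⁅y⁆⇒x≡y _ (subst (_ ∈_) (proj₂ (single i)) x∈i)
    element-block : ∀ v → element (block v) ≡ v
    element-block v = sym (∈⇒≡element (∈-block v))
    block-element : ∀ i → block (element i) ≡ i
    block-element i = coreset-disjoint (∈-block (element i)) (element-∈ i)
    edge-between-elements : ∀ i j →
      (∃[ u ] ∃[ v ] (u ∈ coreset i × v ∈ coreset j × u ⟶ v)) ⇔ element i ⟶ element j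
    edge-between-elements i j = mk⇔
      (λ (u , v , u∈i , v∈j , u⟶v) → subst₂ _⟶_ (∈⇒≡element u∈i) (∈⇒≡element v∈j) u⟶v)
      (λ e → element i , element j , element-∈ i , element-∈ j , e)
    edges : ∀ i j → E (Y D) i j ≡ E D (element i) (element j)
    edges i j = ⇔→≡ (edge-between-elements i j ⇔-∘ Y-edge⇔ i j)

  Iso⇒allSingletons : Iso (Y D) D → AllSingletons
  Iso⇒allSingletons φ = size-Y≡size⇒allSingletons
    (≤-antisym size-Y≤size (injective⇒≤ (Injection.injective (↔⇒↣ (↔-sym (Iso.bij φ))))))

  record UniqueSinkAndPredecessors : Set where
    field
      sink-unique        : ∀ {u v} → IsSink u → IsSink v → u ≡ v
      predecessor-unique : ∀ {u v w} → u ⟶ w → v ⟶ w → u ≡ v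

  allSingletons⇒unique : AllSingletons → UniqueSinkAndPredecessors
  allSingletons⇒unique single = record
    { sink-unique        = sink-unique
    ; predecessor-unique = predecessor-unique
    }
    where
    members-equal : ∀ {i x y} → x ∈ coreset i → y ∈ coreset i → x ≡ y
    members-equal {i} x∈i y∈i =
      let _ , i≡⁅v⁆ = single i in ∈⁅⁆⇒≡ (subst (_ ∈_) i≡⁅v⁆ x∈i) (subst (_ ∈_) i≡⁅v⁆ y∈i)
    sink-unique : ∀ {u v} → IsSink u → IsSink v → u ≡ v
    sink-unique {u} {v} u-sink v-sink with coreset-nonemptyCoreset (block u)
    ... | _ , inj₁ U≡sinks = members-equal (∈-block u) (subst (v ∈_) (sym U≡sinks) (∈sinks⁺ v-sink))
    ... | _ , inj₂ (cU , _) = ⊥-elim (u-sink (proj₂ (Closed.has-successor cU (∈-block u))))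
    predecessor-unique : ∀ {u v w} → u ⟶ w → v ⟶ w → u ≡ v
    predecessor-unique {u} u⟶w v⟶w with coreset-nonemptyCoreset (block u)
    ... | _ , inj₁ U≡sinks = ⊥-elim (∈sinks⁻ (subst (u ∈_) U≡sinks (∈-block u)) u⟶w)
    ... | _ , inj₂ (cU , _) = members-equal (∈-block u) (Closed.pred-closed cU (∈-block u) u⟶w v⟶w)

  singleton-closed : UniqueSinkAndPredecessors → ∀ {x w} → x ⟶ w → Closed ⁅ x ⁆
  singleton-closed unique {x} x⟶w = record
    { nonempty      = x , x∈⁅x⁆ x
    ; has-successor = λ y∈ → subst (λ y → ∃[ w ] y ⟶ w) (sym (x∈⁅y⁆⇒x≡y x y∈)) (_ , x⟶w)
    ; pred-closed   = λ u∈ u⟶v y⟶v → subst (_∈ ⁅ x ⁆)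
        (sym (trans (predecessor-unique y⟶v u⟶v) (x∈⁅y⁆⇒x≡y x u∈))) (x∈⁅x⁆ x)
    }
    where
    open UniqueSinkAndPredecessors unique

  unique⇒allSingletons : UniqueSinkAndPredecessors → AllSingletons
  unique⇒allSingletons unique i =
    representative i , ⊆⁅⁆⇒≡⁅⁆ (representative-∈ i) (≡representative (coreset-nonemptyCoreset i))
    where
    open UniqueSinkAndPredecessors unique
    r = representative i
    r∈i = representative-∈ i
    ≡representative : NonemptyCoreset (coreset i) → ∀ {y} → y ∈ coreset i → y ≡ r
    ≡representative (_ , inj₁ i≡sinks) {y} y∈i =
      sink-unique (∈sinks⁻ (subst (y ∈_) i≡sinks y∈i)) (∈sinks⁻ (subst (r ∈_) i≡sinks r∈i))
    ≡representative (_ , inj₂ (cU , minimal)) {y} y∈i =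
      x∈⁅y⁆⇒x≡y r (subst (y ∈_) (sym (minimal ⁅r⁆-closed ⁅r⁆⊆i)) y∈i)
      where
      ⁅r⁆-closed = singleton-closed unique (proj₂ (Closed.has-successor cU r∈i))
      ⁅r⁆⊆i : ⁅ r ⁆ ⊆ coreset i
      ⁅r⁆⊆i x∈ = subst (_∈ coreset i) (sym (x∈⁅y⁆⇒x≡y r x∈)) r∈i

open CoresetTheory using (UniqueSinkAndPredecessors)

UniqueSinkAndPredecessors-transport : ∀ {G H} → Iso G H → UniqueSinkAndPredecessors H → UniqueSinkAndPredecessors G
UniqueSinkAndPredecessors-transport {G} {H} φ unique = record
  { sink-unique        = λ u-sink v-sink → to-injective (sink-unique (sink→ u-sink) (sink→ v-sink))
  ; predecessor-unique = λ u⟶w v⟶w → to-injective (predecessor-unique (edge→ u⟶w) (edge→ v⟶w))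
  }
  where
  open UniqueSinkAndPredecessors unique
  open Inverse (Iso.bij φ) using (to; from; strictlyInverseˡ)
  to-injective : Injective _≡_ _≡_ to
  to-injective = Injection.injective (↔⇒↣ (Iso.bij φ))
  edge→ : ∀ {u v} → E G u v ≡ true → E H (to u) (to v) ≡ true
  edge→ {u} {v} e = trans (sym (Iso.edges φ u v)) e
  sink→ : ∀ {u} → CoresetTheory.IsSink G u → CoresetTheory.IsSink H (to u)
  sink→ {u} u-sink {w} e =
    u-sink (trans (Iso.edges φ u (from w)) (subst (λ x → E H (to u) x ≡ true) (sym (strictlyInverseˡ w)) e))

Y-iso : ∀ {G} → UniqueSinkAndPredecessors G → Iso (Y G) G
Y-iso {G} = proj₁ ∘ allSingletons⇒Iso ∘ unique⇒allSingletons
  where open CoresetTheory G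

Yⁿ-iso : ∀ {G} → UniqueSinkAndPredecessors G → ∀ m → Iso (Yⁿ m G) G
Yⁿ-iso unique zero    = Iso-refl
Yⁿ-iso unique (suc m) =
  Iso-trans (Y-iso (UniqueSinkAndPredecessors-transport (Yⁿ-iso unique m) unique)) (Yⁿ-iso unique m)

Yⁿ-+ : ∀ m k G → Yⁿ (m + k) G ≡ Yⁿ m (Yⁿ k G)
Yⁿ-+ zero    k G = refl
Yⁿ-+ (suc m) k G = cong Y (Yⁿ-+ m k G)

-- Y either removes a vertex or already fixes the digraph, so size G applications suffice.
Yⁿ-eventually-unique : ∀ fuel G → size G ≤ fuel → ∃[ k ] UniqueSinkAndPredecessors (Yⁿ k G)
Yⁿ-eventually-unique fuel G size≤fuel with CoresetTheory.size-Y<size⊎allSingletons G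
... | inj₂ single = 0 , CoresetTheory.allSingletons⇒unique G single
Yⁿ-eventually-unique zero G size≤0 | inj₁ shrinks = ⊥-elim (n≮0 (<-≤-trans shrinks size≤0))
Yⁿ-eventually-unique (suc fuel) G size≤fuel | inj₁ shrinks =
  let k , unique = Yⁿ-eventually-unique fuel (Y G) (≤-pred (<-≤-trans shrinks size≤fuel))
  in k + 1 , subst UniqueSinkAndPredecessors (sym (Yⁿ-+ k 1 G)) unique

Yⁿ-eventually-constant : ∀ G → ∃[ F ] ∃[ N ] ((n : ℕ) → N ≤ n → Iso (Yⁿ n G) F)
Yⁿ-eventually-constant G with Yⁿ-eventually-unique (size G) G ≤-refl
... | k , unique = Yⁿ k G , k , λ n k≤n →
  subst (λ m → Iso (Yⁿ m G) (Yⁿ k G)) (m∸n+n≡m k≤n)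
        (subst (λ F → Iso F (Yⁿ k G)) (sym (Yⁿ-+ (n ∸ k) k G)) (Yⁿ-iso unique (n ∸ k)))

proposition10 : (D : Digraph) →
    -- (1a) the nonempty coresets partition V(D)
    ((v : Fin (size D)) → ∃[ i ] lookup (List.lookup (coresets D) i) v ≡ true)
    × ((i j : Fin (size (Y D))) (v : Fin (size D)) →
         lookup (List.lookup (coresets D) i) v ≡ true →
         lookup (List.lookup (coresets D) j) v ≡ true → i ≡ j)
    -- (1b) Y(D) is the quotient: edge U_i → U_j iff some u ∈ U_i has a successor v ∈ U_j
    × ((i j : Fin (size (Y D))) →
         (E (Y D) i j ≡ true) ⇔
         (∃[ u ] ∃[ v ] (lookup (List.lookup (coresets D) i) u ≡ true
                        × lookup (List.lookup (coresets D) j) v ≡ true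
                        × E D u v ≡ true)))
    -- (2) Y(D) = D iff every nonempty coreset is a singleton
    × (((i : Fin (size (Y D))) → ∃[ v ] List.lookup (coresets D) i ≡ ⁅ v ⁆) →
         Σ (Iso (Y D) D) λ φ → (i : Fin (size (Y D))) →
           lookup (List.lookup (coresets D) i) (Inverse.to (Iso.bij φ) i) ≡ true)
    × (Iso (Y D) D → (i : Fin (size (Y D))) → ∃[ v ] List.lookup (coresets D) i ≡ ⁅ v ⁆)
    -- (3) Y^n(D) eventually constant up to isomorphism
    × (∃[ F ] ∃[ N ] ((n : ℕ) → N ≤ n → Iso (Yⁿ n D) F))
proposition10 D =
    (λ v → let i , v∈i = coreset-cover v in i , []=⇒lookup v∈i)
  , (λ i j v v∈i v∈j → coreset-disjoint (lookup⇒[]= v _ v∈i) (lookup⇒[]= v _ v∈j))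
  , (λ i j → mk⇔
      (λ e → let u , v , u∈i , v∈j , u⟶v = Equivalence.to (Y-edge⇔ i j) e
             in u , v , []=⇒lookup u∈i , []=⇒lookup v∈j , u⟶v)
      (λ (u , v , u∈i , v∈j , u⟶v) →
        Equivalence.from (Y-edge⇔ i j) (u , v , lookup⇒[]= u _ u∈i , lookup⇒[]= v _ v∈j , u⟶v)))
  , (λ single → let φ , φ∈ = allSingletons⇒Iso single in φ , []=⇒lookup ∘ φ∈)
  , Iso⇒allSingletons
  , Yⁿ-eventually-constant D
  where
  open CoresetTheory D
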